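{- Let $G$ be a strongly connected directed co-graph with co-tree $T$, let $\hat w$ be an inner node of $T$, and let $R_{\hat w}\subseteq V(G_{\hat w})$ be a resolving set for $V(G_{\hat w})$ in $G$ such that $G_{\hat w}$ has a 1-vertex $u_1$ and a 2-vertex $u_2$ w.r.t. $R_{\hat w}$. Then there is no vertex $v\in V(G_{\hat w})\setminus\{u_1,u_2\}$ such that $R_{\hat w}\cup\{v\}$ is a resolving set for $V(G_{\hat w})$ in $G$ and $G_{\hat w}$ has neither a 1-vertex nor a 2-vertex w.r.t. $R_{\hat w}\cup\{v\}$.
   Context: All graphs are finite and simple. For vertices $u,v$ of a directed graph $G$, $d_G(u,v)$ is the length of a shortest directed path from $u$ to $v$ (undefined if none exists). $G$ is strongly connected if there is a directed path between every ordered pair of vertices. Two distinct vertices $u,v$ are resolved by $w$ in $G$ if $w=u$, or $w=v$, or there are paths from $w$ to $u$ and to $v$ with $d_G(w,u)\neq d_G(w,v)$. For $U\subseteq V(G)$, a set $R\subseteq U$ is a resolving set for $U$ in $G$ if every pair of distinct vertices of $U$ is resolved in $G$ by some vertex of $R$. For a non-empty $R\subseteq V(H)$ of a directed graph $H$, a vertex $u\in V(H)\setminus R$ is a 1-vertex w.r.t. $R$ if $(w,u)\in E(H)$ for all $w\in R$, and a 2-vertex w.r.t. $R$ if $(w,u)\notin E(H)$ for all $w\in R$. Directed co-graphs and co-trees are defined recursively: a single vertex $u$ is a directed co-graph with co-tree a single leaf node associated with $u$. If $G_1,G_2$ are directed co-graphs on disjoint vertex sets with co-trees $T_1,T_2$,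 then $G_1\cup G_2$ (edges $E(G_1)\cup E(G_2)$), $G_1\times G_2$ (additionally all $(u,v),(v,u)$, $u\in V(G_1)$, $v\in V(G_2)$) and $G_1\gg G_2$ (additionally all $(u,v)$, $u\in V(G_1)$, $v\in V(G_2)$) are directed co-graphs; the co-tree is $T_1,T_2$ plus a new root labelled $\cup$, $\times$, $\gg$ respectively, whose two successors are the roots of $T_1,T_2$. Non-leaf nodes are inner nodes. For a node $\hat w$, $G_{\hat w}$ is the subgraph of $G$ induced by the vertices associated with leaves of the subtree rooted at $\hat w$. -}

module Defs where

open import Data.Nat using (ℕ; zero; suc; _<_)
open import Data.Product using (Σ; _×_; _,_; ∃)
open import Data.Sum using (_⊎_)
open import Data.Empty using (⊥)
open import Data.Unit using (⊤)
open import Data.List using (List)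
open import Data.List.Relation.Unary.Any using (Any)
open import Data.List.Membership.Propositional using (_∈_; _∉_)
open import Relation.Nullary using (¬_)
open import Relation.Binary.PropositionalEquality using (_≡_; _≢_)

data Op : Set where
  union prod ser : Op

-- A co-tree (binary tree; leaves are vertices, inner nodes labelled by Op).
-- The directed co-graph G is the one generated by the co-tree.
data CoTree : Set where
  leaf : CoTree
  node : Op → CoTree → CoTree → CoTree

data Vtx : CoTree → Set where
  here  : Vtx leaf
  left  : ∀ {o t₁ t₂} → Vtx t₁ → Vtx (node o t₁ t₂)
  right : ∀ {o t₁ t₂} → Vtx t₂ → Vtx (node o t₁ t₂)

Edge : (t : CoTree) → Vtx t → Vtx t → Set
Edge leaf here here = ⊥
Edge (node o t₁ t₂) (left u)  (left v)  = Edge t₁ u v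
Edge (node o t₁ t₂) (right u) (right v) = Edge t₂ u v
Edge (node union t₁ t₂) (left u)  (right v) = ⊥
Edge (node union t₁ t₂) (right u) (left v)  = ⊥
Edge (node prod t₁ t₂) (left u)  (right v) = ⊤
Edge (node prod t₁ t₂) (right u) (left v)  = ⊤
Edge (node ser t₁ t₂) (left u)  (right v) = ⊤
Edge (node ser t₁ t₂) (right u) (left v)  = ⊥

data Walk (t : CoTree) : Vtx t → Vtx t → ℕ → Set where
  stop : ∀ {u} → Walk t u u zero
  step : ∀ {u v w n} → Edge t u v → Walk t v w n → Walk t u w (suc n)

Dist : (t : CoTree) → Vtx t → Vtx t → ℕ → Set
Dist t u v n = Walk t u v n × (∀ m → m < n → ¬ Walk t u v m)

StronglyConnected : CoTree → Set
StronglyConnected t = ∀ (u v : Vtx t) → ∃ λ n → Walk t u v n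

data Pos : CoTree → Set where
  root : ∀ {t} → Pos t
  inL  : ∀ {o t₁ t₂} → Pos t₁ → Pos (node o t₁ t₂)
  inR  : ∀ {o t₁ t₂} → Pos t₂ → Pos (node o t₁ t₂)

sub : (t : CoTree) → Pos t → CoTree
sub t root = t
sub (node o t₁ t₂) (inL p) = sub t₁ p
sub (node o t₁ t₂) (inR p) = sub t₂ p

emb : (t : CoTree) (p : Pos t) → Vtx (sub t p) → Vtx t
emb t root x = x
emb (node o t₁ t₂) (inL p) x = left (emb t₁ p x)
emb (node o t₁ t₂) (inR p) x = right (emb t₂ p x)

Inner : CoTree → Set
Inner leaf = ⊥
Inner (node _ _ _) = ⊤

Resolves : (t : CoTree) → Vtx t → Vtx t → Vtx t → Set
Resolves t w u v =
  w ≡ u ⊎ w ≡ v ⊎ Σ ℕ λ n → Σ ℕ λ m → Dist t w u n × Dist t w v m × n ≢ m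

Resolving : (t : CoTree) (p : Pos t) → List (Vtx (sub t p)) → Set
Resolving t p R = ∀ (x y : Vtx (sub t p)) → x ≢ y →
  Any (λ w → Resolves t (emb t p w) (emb t p x) (emb t p y)) R

OneVertex : (t : CoTree) (p : Pos t) → List (Vtx (sub t p)) → Vtx (sub t p) → Set
OneVertex t p R u = u ∉ R × (∀ w → w ∈ R → Edge t (emb t p w) (emb t p u))

TwoVertex : (t : CoTree) (p : Pos t) → List (Vtx (sub t p)) → Vtx (sub t p) → Set
TwoVertex t p R u = u ∉ R × (∀ w → w ∈ R → ¬ Edge t (emb t p w) (emb t p u))

-- A vertex v that rescues R from having a 1-vertex u₁ and a 2-vertex u₂ must avoid u₁ and
-- reach u₂. Some a ∈ R resolves v and u₁; as a → u₁, a ↛ v. Some b ∈ R resolves v and u₂;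
-- as b ↛ u₂ and a strongly connected co-graph has diameter 2, b → v. Together with
-- R → u₁ and R ↛ u₂ this gives the edge pattern a → u₁ ← b → v → u₂, a ↛ v, a ↛ u₂,
-- b ↛ u₂, v ↛ u₁, which no directed co-graph contains: at the co-tree node that first
-- separates the five vertices, the edges between its two sides are all present, all absent,
-- or all oriented one way, and in each case the pattern forces all five onto one side.
module Submission where

open import Defs
open import Data.Bool using (Bool; true; false; _≤_; b≤b; f≤t)
open import Data.Bool.Properties using (≤-antisym; ≤-trans)
open import Data.Empty using (⊥-elim)
open import Data.List using (List; []; _∷_)
open import Data.List.Membership.Propositional using (_∈_; _∉_; find)
open import Data.List.Relation.Unary.Any using (here; there)
open import Data.Nat using (ℕ; zero; suc; s≤s)
open import Data.Nat.Properties using (<-cmp)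
open import Data.Product using (Σ; _×_; _,_; proj₂)
open import Data.Sum using (inj₁; inj₂)
open import Data.Unit using (tt)
open import Function using (_∘_)
open import Relation.Binary using (Decidable; tri<; tri≈; tri>)
open import Relation.Binary.PropositionalEquality using (_≡_; _≢_; refl; sym; trans; subst)
open import Relation.Nullary using (¬_; yes; no)
open import Relation.Nullary.Decidable using (decidable-stable)

private
  variable
    o : Op
    t t₁ t₂ : CoTree
    n m : ℕ

edge? : (t : CoTree) → Decidable (Edge t)
edge? leaf here here = no λ ()
edge? (node o t₁ t₂) (left u) (left v) = edge? t₁ u v
edge? (node o t₁ t₂) (right u) (right v) = edge? t₂ u v
edge? (node union t₁ t₂) (left u) (right v) = no λ ()
edge? (node union t₁ t₂) (right u) (left v) = no λ ()
edge? (node prod t₁ t₂) (left u) (right v) = yes tt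
edge? (node prod t₁ t₂) (right u) (left v) = yes tt
edge? (node ser t₁ t₂) (left u) (right v) = yes tt
edge? (node ser t₁ t₂) (right u) (left v) = no λ ()

aVertex : (t : CoTree) → Vtx t
aVertex leaf = here
aVertex (node o t₁ t₂) = left (aVertex t₁)

emb-injective : ∀ t p {x y : Vtx (sub t p)} → emb t p x ≡ emb t p y → x ≡ y
emb-injective t root eq = eq
emb-injective (node o t₁ t₂) (inL p) eq = emb-injective t₁ p (left-injective eq)
  where
  left-injective : ∀ {x y : Vtx t₁} → left {o} {t₁} {t₂} x ≡ left y → x ≡ y
  left-injective refl = refl
emb-injective (node o t₁ t₂) (inR p) eq = emb-injective t₂ p (right-injective eq)
  where
  right-injective : ∀ {x y : Vtx t₂} → right {o} {t₁} {t₂} x ≡ right y → x ≡ y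
  right-injective refl = refl

emb-∈-∉⇒≢ : ∀ {t p} {R : List (Vtx (sub t p))} {w x} → w ∈ R → x ∉ R → emb t p w ≢ emb t p x
emb-∈-∉⇒≢ {t} {p} {R} w∈R x∉R eq = x∉R (subst (_∈ R) (emb-injective t p eq) w∈R)

Walk-zero⇒≡ : ∀ {x y} → Walk t x y 0 → x ≡ y
Walk-zero⇒≡ stop = refl

Dist-unique : ∀ {x y} → Dist t x y n → Dist t x y m → n ≡ m
Dist-unique {n = n} {m = m} (walkₙ , minₙ) (walkₘ , minₘ) with <-cmp n m
... | tri< n<m _ _ = ⊥-elim (minₘ n n<m walkₙ)
... | tri≈ _ n≡m _ = n≡m
... | tri> _ _ m<n = ⊥-elim (minₙ m m<n walkₘ)

Dist-adjacent : ∀ {x y} → x ≢ y → Edge t x y → Dist t x y 1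
Dist-adjacent x≢y x→y = step x→y stop , λ { zero _ w → x≢y (Walk-zero⇒≡ w) ; (suc _) (s≤s ()) _ }

Dist-nonadjacent : ∀ {x y} → x ≢ y → ¬ Edge t x y → Walk t x y 2 → Dist t x y 2
Dist-nonadjacent x≢y x↛y walk = walk , λ
  { zero _ w → x≢y (Walk-zero⇒≡ w)
  ; (suc zero) _ (step x→y stop) → x↛y x→y
  ; (suc (suc _)) (s≤s (s≤s ())) _
  }

side : Vtx (node o t₁ t₂) → Bool
side (left _) = false
side (right _) = true

union-edge⇒sameSide : ∀ {x y} → Edge (node union t₁ t₂) x y → side x ≡ side y
union-edge⇒sameSide {x = left _} {left _} _ = refl
union-edge⇒sameSide {x = right _} {right _} _ = refl

prod-nonEdge⇒sameSide : ∀ {x y} → ¬ Edge (node prod t₁ t₂) x y → side x ≡ side y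
prod-nonEdge⇒sameSide {x = left _} {left _} _ = refl
prod-nonEdge⇒sameSide {x = left _} {right _} x↛y = ⊥-elim (x↛y tt)
prod-nonEdge⇒sameSide {x = right _} {left _} x↛y = ⊥-elim (x↛y tt)
prod-nonEdge⇒sameSide {x = right _} {right _} _ = refl

ser-edge⇒side-≤ : ∀ {x y} → Edge (node ser t₁ t₂) x y → side x ≤ side y
ser-edge⇒side-≤ {x = left _} {left _} _ = b≤b
ser-edge⇒side-≤ {x = left _} {right _} _ = f≤t
ser-edge⇒side-≤ {x = right _} {right _} _ = b≤b

ser-nonEdge⇒side-≥ : ∀ {x y} → ¬ Edge (node ser t₁ t₂) x y → side y ≤ side x
ser-nonEdge⇒side-≥ {x = left _} {left _} _ = b≤b
ser-nonEdge⇒side-≥ {x = left _} {right _} x↛y = ⊥-elim (x↛y tt)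
ser-nonEdge⇒side-≥ {x = right _} {left _} _ = f≤t
ser-nonEdge⇒side-≥ {x = right _} {right _} _ = b≤b

union-walk⇒sameSide : ∀ {x y} → Walk (node union t₁ t₂) x y n → side x ≡ side y
union-walk⇒sameSide stop = refl
union-walk⇒sameSide (step e w) = trans (union-edge⇒sameSide e) (union-walk⇒sameSide w)

ser-walk⇒side-≤ : ∀ {x y} → Walk (node ser t₁ t₂) x y n → side x ≤ side y
ser-walk⇒side-≤ stop = b≤b
ser-walk⇒side-≤ (step e w) = ≤-trans (ser-edge⇒side-≤ e) (ser-walk⇒side-≤ w)

data SameSide {o t₁ t₂} : Vtx (node o t₁ t₂) → Vtx (node o t₁ t₂) → Set where
  bothLeft  : ∀ {x y} → SameSide (left x) (left y)
  bothRight : ∀ {x y} → SameSide (right x) (right y)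

sameSide : (x y : Vtx (node o t₁ t₂)) → side x ≡ side y → SameSide x y
sameSide (left _) (left _) _ = bothLeft
sameSide (right _) (right _) _ = bothRight

stronglyConnected⇒prod : StronglyConnected (node o t₁ t₂) → o ≡ prod
stronglyConnected⇒prod {union} {t₁} {t₂} sc
  with () ← union-walk⇒sameSide (proj₂ (sc (left (aVertex t₁)) (right (aVertex t₂))))
stronglyConnected⇒prod {prod} sc = refl
stronglyConnected⇒prod {ser} {t₁} {t₂} sc
  with () ← ser-walk⇒side-≤ (proj₂ (sc (right (aVertex t₂)) (left (aVertex t₁))))

prod-nonEdge⇒walk₂ : ∀ {x y} → ¬ Edge (node prod t₁ t₂) x y → Walk (node prod t₁ t₂) x y 2
prod-nonEdge⇒walk₂ {t₂ = t₂} {x = left _} {left _} _ = step {v = right (aVertex t₂)} tt (step tt stop)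
prod-nonEdge⇒walk₂ {t₁ = t₁} {x = right _} {right _} _ = step {v = left (aVertex t₁)} tt (step tt stop)
prod-nonEdge⇒walk₂ {x = left _} {right _} x↛y = ⊥-elim (x↛y tt)
prod-nonEdge⇒walk₂ {x = right _} {left _} x↛y = ⊥-elim (x↛y tt)

nonEdge⇒walk₂ : StronglyConnected t → ∀ {x y} → x ≢ y → ¬ Edge t x y → Walk t x y 2
nonEdge⇒walk₂ {leaf} _ {here} {here} x≢y _ = ⊥-elim (x≢y refl)
nonEdge⇒walk₂ {node o t₁ t₂} sc x≢y x↛y with refl ← stronglyConnected⇒prod sc = prod-nonEdge⇒walk₂ x↛y

Resolves-distinct : ∀ {w x y} → w ≢ x → w ≢ y → Resolves t w x y →
  Σ ℕ λ n → Σ ℕ λ m → Dist t w x n × Dist t w y m × n ≢ m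
Resolves-distinct w≢x _ (inj₁ w≡x) = ⊥-elim (w≢x w≡x)
Resolves-distinct _ w≢y (inj₂ (inj₁ w≡y)) = ⊥-elim (w≢y w≡y)
Resolves-distinct _ _ (inj₂ (inj₂ distances)) = distances

Resolves-adjacent : ∀ {w x y} → w ≢ x → w ≢ y → Resolves t w x y → Edge t w y → ¬ Edge t w x
Resolves-adjacent w≢x w≢y res w→y w→x with Resolves-distinct w≢x w≢y res
... | _ , _ , dx , dy , n≢m =
  n≢m (trans (Dist-unique dx (Dist-adjacent w≢x w→x)) (Dist-unique (Dist-adjacent w≢y w→y) dy))

Resolves-nonadjacent : StronglyConnected t → ∀ {w x y} → w ≢ x → w ≢ y → Resolves t w x y →
  ¬ Edge t w y → Edge t w x
Resolves-nonadjacent {t} sc {w} {x} w≢x w≢y res w↛y = decidable-stable (edge? t w x) λ w↛x →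
  let _ , _ , dx , dy , n≢m = Resolves-distinct w≢x w≢y res in
  n≢m (trans (Dist-unique dx (distance-two w≢x w↛x)) (Dist-unique (distance-two w≢y w↛y) dy))
  where
  distance-two : ∀ {z} → w ≢ z → ¬ Edge t w z → Dist t w z 2
  distance-two w≢z w↛z = Dist-nonadjacent w≢z w↛z (nonEdge⇒walk₂ sc w≢z w↛z)

Obstruction : (t : CoTree) (a b v u₁ u₂ : Vtx t) → Set
Obstruction t a b v u₁ u₂ =
  (Edge t a u₁ × Edge t b u₁ × Edge t b v × Edge t v u₂) ×
  (¬ Edge t a u₂ × ¬ Edge t a v × ¬ Edge t b u₂ × ¬ Edge t v u₁)

OnOneSide : (a b v u₁ u₂ : Vtx (node o t₁ t₂)) → Set
OnOneSide a b v u₁ u₂ = side a ≡ side b × side a ≡ side v × side a ≡ side u₁ × side a ≡ side u₂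

Obstruction⇒onOneSide : ∀ o {a b v u₁ u₂ : Vtx (node o t₁ t₂)} →
  Obstruction (node o t₁ t₂) a b v u₁ u₂ → OnOneSide a b v u₁ u₂
Obstruction⇒onOneSide union ((a→u₁ , b→u₁ , b→v , v→u₂) , _) =
  a~b , a~v , a~u₁ , trans a~v (union-edge⇒sameSide v→u₂)
  where
  a~u₁ = union-edge⇒sameSide a→u₁
  a~b = trans a~u₁ (sym (union-edge⇒sameSide b→u₁))
  a~v = trans a~b (union-edge⇒sameSide b→v)
Obstruction⇒onOneSide prod (_ , (a↛u₂ , a↛v , b↛u₂ , v↛u₁)) =
  a~b , a~v , trans a~v (prod-nonEdge⇒sameSide v↛u₁) , a~u₂
  where
  a~u₂ = prod-nonEdge⇒sameSide a↛u₂
  a~v = prod-nonEdge⇒sameSide a↛v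
  a~b = trans a~u₂ (sym (prod-nonEdge⇒sameSide b↛u₂))
Obstruction⇒onOneSide ser ((a→u₁ , _ , b→v , v→u₂) , (a↛u₂ , a↛v , b↛u₂ , v↛u₁)) =
  ≤-antisym (≤-trans a≤u₂ u₂≤b) (≤-trans b≤v v≤a) ,
  ≤-antisym (≤-trans a≤u₁ u₁≤v) v≤a ,
  ≤-antisym a≤u₁ (≤-trans u₁≤v (≤-trans v≤u₂ u₂≤a)) ,
  ≤-antisym a≤u₂ u₂≤a
  where
  a≤u₁ = ser-edge⇒side-≤ a→u₁
  b≤v = ser-edge⇒side-≤ b→v
  v≤u₂ = ser-edge⇒side-≤ v→u₂
  u₂≤a = ser-nonEdge⇒side-≥ a↛u₂
  v≤a = ser-nonEdge⇒side-≥ a↛v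
  u₂≤b = ser-nonEdge⇒side-≥ b↛u₂
  u₁≤v = ser-nonEdge⇒side-≥ v↛u₁
  a≤u₂ = ≤-trans a≤u₁ (≤-trans u₁≤v v≤u₂)

no-obstruction : ∀ t {a b v u₁ u₂} → ¬ Obstruction t a b v u₁ u₂
no-obstruction leaf {here} {u₁ = here} ((a→u₁ , _) , _) = a→u₁
no-obstruction (node o t₁ t₂) {a} {b} {v} {u₁} {u₂} obs with Obstruction⇒onOneSide o obs
... | a~b , a~v , a~u₁ , a~u₂
  with sameSide a b a~b | sameSide a v a~v | sameSide a u₁ a~u₁ | sameSide a u₂ a~u₂
... | bothLeft  | bothLeft  | bothLeft  | bothLeft  = no-obstruction t₁ obs
... | bothRight | bothRight | bothRight | bothRight = no-obstruction t₂ obs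

∉-∷ : ∀ {A : Set} {x y : A} {xs} → y ≢ x → y ∉ xs → y ∉ x ∷ xs
∉-∷ y≢x _ (here y≡x) = y≢x y≡x
∉-∷ _ y∉xs (there y∈xs) = y∉xs y∈xs

OneVertex-∷ : ∀ {t p R v u} → u ≢ v → OneVertex t p R u →
  Edge t (emb t p v) (emb t p u) → OneVertex t p (v ∷ R) u
OneVertex-∷ u≢v (u∉R , R→u) v→u = ∉-∷ u≢v u∉R , λ { _ (here refl) → v→u ; w (there w∈R) → R→u w w∈R }

TwoVertex-∷ : ∀ {t p R v u} → u ≢ v → TwoVertex t p R u →
  ¬ Edge t (emb t p v) (emb t p u) → TwoVertex t p (v ∷ R) u
TwoVertex-∷ u≢v (u∉R , R↛u) v↛u = ∉-∷ u≢v u∉R , λ { _ (here refl) → v↛u ; w (there w∈R) → R↛u w w∈R }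

lemma3 : (t : CoTree) → StronglyConnected t → (p : Pos t) → Inner (sub t p) →
    (R : List (Vtx (sub t p))) → R ≢ [] → Resolving t p R →
    (u₁ u₂ : Vtx (sub t p)) → OneVertex t p R u₁ → TwoVertex t p R u₂ →
    ¬ (Σ (Vtx (sub t p)) λ v → v ≢ u₁ × v ≢ u₂ × Resolving t p (v ∷ R)
         × (∀ x → ¬ OneVertex t p (v ∷ R) x)
         × (∀ x → ¬ TwoVertex t p (v ∷ R) x))
lemma3 t sc p _ R _ resolving u₁ u₂ one@(u₁∉R , R→u₁) two@(u₂∉R , R↛u₂) (v , v≢u₁ , v≢u₂ , _ , no-one , no-two)
  with find (resolving v u₁ v≢u₁) | find (resolving v u₂ v≢u₂)
... | a , a∈R , a-resolves | b , b∈R , b-resolves =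
  no-obstruction t ((R→u₁ a a∈R , R→u₁ b b∈R , b→v , v→u₂) , (R↛u₂ a a∈R , a↛v , R↛u₂ b b∈R , v↛u₁))
  where
  v↛u₁ : ¬ Edge t (emb t p v) (emb t p u₁)
  v↛u₁ = no-one u₁ ∘ OneVertex-∷ {t} {p} (v≢u₁ ∘ sym) one
  v→u₂ : Edge t (emb t p v) (emb t p u₂)
  v→u₂ = decidable-stable (edge? t _ _) (no-two u₂ ∘ TwoVertex-∷ {t} {p} (v≢u₂ ∘ sym) two)
  v∉R : v ∉ R
  v∉R = v↛u₁ ∘ R→u₁ v
  a↛v : ¬ Edge t (emb t p a) (emb t p v)
  a↛v = Resolves-adjacent (emb-∈-∉⇒≢ a∈R v∉R) (emb-∈-∉⇒≢ a∈R u₁∉R) a-resolves (R→u₁ a a∈R)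
  b→v : Edge t (emb t p b) (emb t p v)
  b→v = Resolves-nonadjacent sc (emb-∈-∉⇒≢ b∈R v∉R) (emb-∈-∉⇒≢ b∈R u₂∉R) b-resolves (R↛u₂ b b∈R)
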